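{- Let $\beta$ be odd and let $\mathcal C=\langle (b\mid 0),(\ell\mid fh+2f)\rangle$ be a $\mathbb{Z}_2\mathbb{Z}_4$-additive cyclic code in $R_{\alpha,\beta}=\mathbb{Z}_2[x]/(x^\alpha-1)\times\mathbb{Z}_4[x]/(x^\beta-1)$, where $f,g,h\in\mathbb{Z}_4[x]$ are monic with $fhg=x^\beta-1$, $b,\ell\in\mathbb{Z}_2[x]$, $b\mid x^\alpha-1$, $\deg(\ell)<\deg(b)$, and $b$ divides $\frac{x^\beta-1}{f}\ell \pmod 2$. Then $b$ divides $\frac{x^\beta-1}{f}\gcd(b,\ell)\pmod 2$ and $b$ divides $h\gcd(b,\ell g)\pmod 2$.
   Context: A $\mathbb{Z}_2\mathbb{Z}_4$-additive code is a subgroup of $\mathbb{Z}_2^\alpha\times\mathbb{Z}_4^\beta$; it is cyclic if it is invariant under the map $(u_0,\dots,u_{\alpha-1}\mid u'_0,\dots,u'_{\beta-1})\mapsto(u_{1},\dots,u_{\alpha-1},u_0\mid u'_{1},\dots,u'_{\beta-1},u'_0)$. Vectors are identified with polynomials, so cyclic codes are the $\mathbb{Z}_4[x]$-submodules of $R_{\alpha,\beta}$ under $\lambda\star(p\mid q)=(\lambda p\bmod 2\mid \lambda q)$, and $\langle\cdot\rangle$ denotes the generated submodule. Quaternary polynomials appearing together with binary ones (e.g. in $\gcd(b,\ell g)$ or $h\gcd(\cdot)$) are reduced modulo 2; gcds are taken in $\mathbb{Z}_2[x]$. -}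

module Defs where

open import Data.Nat using (ℕ; zero; suc) public
open import Data.Nat.Properties using ()
open import Data.List using (List; []; _∷_; map; replicate; _++_) public
open import Data.List.Relation.Unary.All using (All) public
open import Data.Maybe using (Maybe; just; nothing) public
open import Data.Bool using (Bool; true; false; if_then_else_) public
open import Data.Product using (Σ; _×_; _,_; ∃) public
open import Data.Unit using (⊤)
open import Data.Empty using (⊥)
open import Relation.Binary.PropositionalEquality using (_≡_) public

data ℤ₂ : Set where
  0₂ 1₂ : ℤ₂

_+₂_ : ℤ₂ → ℤ₂ → ℤ₂
0₂ +₂ b = b
1₂ +₂ 0₂ = 1₂
1₂ +₂ 1₂ = 0₂

_*₂_ : ℤ₂ → ℤ₂ → ℤ₂
0₂ *₂ b = 0₂
1₂ *₂ b = b

isZero₂ : ℤ₂ → Bool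
isZero₂ 0₂ = true
isZero₂ 1₂ = false

data ℤ₄ : Set where
  0₄ 1₄ 2₄ 3₄ : ℤ₄

suc₄ : ℤ₄ → ℤ₄
suc₄ 0₄ = 1₄
suc₄ 1₄ = 2₄
suc₄ 2₄ = 3₄
suc₄ 3₄ = 0₄

_+₄_ : ℤ₄ → ℤ₄ → ℤ₄
0₄ +₄ b = b
1₄ +₄ b = suc₄ b
2₄ +₄ b = suc₄ (suc₄ b)
3₄ +₄ b = suc₄ (suc₄ (suc₄ b))

_*₄_ : ℤ₄ → ℤ₄ → ℤ₄
0₄ *₄ b = 0₄
1₄ *₄ b = b
2₄ *₄ b = b +₄ b
3₄ *₄ b = b +₄ (b +₄ b)

isZero₄ : ℤ₄ → Bool
isZero₄ 0₄ = true
isZero₄ _  = false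

red : ℤ₄ → ℤ₂
red 0₄ = 0₂
red 1₄ = 1₂
red 2₄ = 0₂
red 3₄ = 1₂

-- Polynomials over a (commutative) ring given by its operations,
-- as little-endian coefficient lists; equality is up to trailing zeros.

module Poly (A : Set) (0# 1# : A) (_+_ _*_ : A → A → A) (isZero : A → Bool) where

  Pol : Set
  Pol = List A

  infixl 6 _⊕_
  infixl 7 _⊗_
  infix 4 _≈_ _∣_

  _⊕_ : Pol → Pol → Pol
  [] ⊕ q = q
  (a ∷ p) ⊕ [] = a ∷ p
  (a ∷ p) ⊕ (b ∷ q) = (a + b) ∷ (p ⊕ q)

  scale : A → Pol → Pol
  scale a p = map (a *_) p

  _⊗_ : Pol → Pol → Pol
  [] ⊗ q = []
  (a ∷ p) ⊗ q = scale a q ⊕ (0# ∷ (p ⊗ q))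

  IsZeroPoly : Pol → Set
  IsZeroPoly p = All (_≡ 0#) p

  _≈_ : Pol → Pol → Set
  [] ≈ q = IsZeroPoly q
  (a ∷ p) ≈ [] = IsZeroPoly (a ∷ p)
  (a ∷ p) ≈ (b ∷ q) = (a ≡ b) × (p ≈ q)

  _∣_ : Pol → Pol → Set
  d ∣ p = Σ Pol λ r → r ⊗ d ≈ p

  -- degree; nothing stands for deg 0 = -∞
  deg : Pol → Maybe ℕ
  deg [] = nothing
  deg (a ∷ p) with deg p
  ... | just n = just (suc n)
  ... | nothing = if isZero a then nothing else just zero

  _<ᵈ_ : Maybe ℕ → Maybe ℕ → Set
  _ <ᵈ nothing = ⊥
  nothing <ᵈ just _ = ⊤
  just m <ᵈ just n = Data.Nat._<_ m n

  coeff : ℕ → Pol → A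
  coeff n [] = 0#
  coeff zero (a ∷ p) = a
  coeff (suc n) (a ∷ p) = coeff n p

  Monic : Pol → Set
  Monic p = Σ ℕ λ n → (deg p ≡ just n) × (coeff n p ≡ 1#)

  X^ : ℕ → Pol
  X^ n = replicate n 0# ++ (1# ∷ [])

  IsGcd : Pol → Pol → Pol → Set
  IsGcd d p q = (d ∣ p) × (d ∣ q) × (∀ e → e ∣ p → e ∣ q → e ∣ d)

module P₂ = Poly ℤ₂ 0₂ 1₂ _+₂_ _*₂_ isZero₂
module P₄ = Poly ℤ₄ 0₄ 1₄ _+₄_ _*₄_ isZero₄

xⁿ-1₂ : ℕ → P₂.Pol
xⁿ-1₂ n = P₂._⊕_ (1₂ ∷ []) (P₂.X^ n)

xⁿ-1₄ : ℕ → P₄.Pol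
xⁿ-1₄ n = P₄._⊕_ (3₄ ∷ []) (P₄.X^ n)

red-pol : P₄.Pol → P₂.Pol
red-pol = map red

Odd : ℕ → Set
Odd n = Σ ℕ λ k → n ≡ suc (k Data.Nat.+ k)

module Submission where

-- Everything happens in ℤ₂[x], after reducing the quaternary data modulo 2.
--
--  * ℤ₂[x] (coefficient lists up to trailing zeros) is a commutative ring of
--    characteristic 2 without zero divisors.  Equality of polynomials is
--    coefficientwise equality, which reduces the additive laws to ℤ₂.
--  * Euclid's algorithm (cancel the leading term of the longer polynomial by
--    a shifted copy of the shorter one) gives, for all a and b, a common
--    divisor g with a Bézout identity u a + v b = g.
--  * Hence if b ∣ m ℓ then b ∣ m d for every gcd d of b and ℓ: b divides
--    m g = u (m b) + v (m ℓ), and d is a multiple of g.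
--  * Reduction modulo 2 is a ring homomorphism ℤ₄[x] → ℤ₂[x].  Reducing
--    f q = x^β - 1 = (f h) g and cancelling the (nonzero) reduction of the
--    monic f gives q ≡ h g (mod 2).
-- The first claim of the theorem is the gcd lemma with m = q mod 2, the
-- second is the gcd lemma with m = h mod 2, because q ℓ ≡ h (ℓ g) (mod 2).

open import Defs
open import Data.Nat using (_+_; _≤_; _<_; z≤n; s≤s; _≤?_; _∸_)
open import Data.Nat.Properties
  using (≤-trans; ≤-refl; +-monoʳ-<; +-monoˡ-<; m∸n+n≡m; suc-injective; ≰⇒>; <⇒≤)
open import Data.List using (length)
open import Data.List.Properties using (length-++; length-replicate)
open import Data.List.Relation.Unary.All using ([]; _∷_)
open import Data.Sum using (_⊎_; inj₁; inj₂)
open import Data.Empty using (⊥-elim)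
open import Relation.Nullary using (¬_; yes; no)
open import Relation.Binary.PropositionalEquality
  using (refl; sym; trans; cong; cong₂)
open import Relation.Binary.Bundles using (Setoid)

module Coefficientwise (A : Set) (0# 1# : A) (_+ᴬ_ _*ᴬ_ : A → A → A) (isZero : A → Bool) where
  open Poly A 0# 1# _+ᴬ_ _*ᴬ_ isZero

  zero-coeff : ∀ {p} → IsZeroPoly p → ∀ n → coeff n p ≡ 0#
  zero-coeff [] n = refl
  zero-coeff (c≡0 ∷ _) zero = c≡0
  zero-coeff (_ ∷ rest) (suc n) = zero-coeff rest n

  coeff-zero : ∀ p → (∀ n → coeff n p ≡ 0#) → IsZeroPoly p
  coeff-zero [] _ = []
  coeff-zero (_ ∷ p) z = z zero ∷ coeff-zero p (λ n → z (suc n))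

  coeff-≈ : ∀ {p q} → p ≈ q → ∀ n → coeff n p ≡ coeff n q
  coeff-≈ {[]} z n = sym (zero-coeff z n)
  coeff-≈ {_ ∷ _} {[]} z n = zero-coeff z n
  coeff-≈ {_ ∷ _} {_ ∷ _} (a≡b , _) zero = a≡b
  coeff-≈ {_ ∷ _} {_ ∷ _} (_ , p≈q) (suc n) = coeff-≈ p≈q n

  ≈-coeff : ∀ {p q} → (∀ n → coeff n p ≡ coeff n q) → p ≈ q
  ≈-coeff {[]} {q} e = coeff-zero q (λ n → sym (e n))
  ≈-coeff {a ∷ p} {[]} e = coeff-zero (a ∷ p) e
  ≈-coeff {_ ∷ _} {_ ∷ _} e = e zero , ≈-coeff (λ n → e (suc n))

  ≈-refl : ∀ {p} → p ≈ p
  ≈-refl = ≈-coeff (λ _ → refl)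

  ≈-sym : ∀ {p q} → p ≈ q → q ≈ p
  ≈-sym e = ≈-coeff (λ n → sym (coeff-≈ e n))

  ≈-trans : ∀ {p q r} → p ≈ q → q ≈ r → p ≈ r
  ≈-trans e e′ = ≈-coeff (λ n → trans (coeff-≈ e n) (coeff-≈ e′ n))

  ≈-setoid : Setoid _ _
  ≈-setoid = record
    { Carrier = Pol ; _≈_ = _≈_
    ; isEquivalence = record { refl = ≈-refl ; sym = ≈-sym ; trans = ≈-trans } }

open P₂
open Coefficientwise ℤ₂ 0₂ 1₂ _+₂_ _*₂_ isZero₂
open import Relation.Binary.Reasoning.Setoid ≈-setoid

+₂-identityʳ : ∀ x → x +₂ 0₂ ≡ x
+₂-identityʳ 0₂ = refl
+₂-identityʳ 1₂ = refl

+₂-comm : ∀ x y → x +₂ y ≡ y +₂ x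
+₂-comm 0₂ 0₂ = refl
+₂-comm 0₂ 1₂ = refl
+₂-comm 1₂ 0₂ = refl
+₂-comm 1₂ 1₂ = refl

+₂-assoc : ∀ x y z → (x +₂ y) +₂ z ≡ x +₂ (y +₂ z)
+₂-assoc 0₂ _ _ = refl
+₂-assoc 1₂ 0₂ _ = refl
+₂-assoc 1₂ 1₂ 0₂ = refl
+₂-assoc 1₂ 1₂ 1₂ = refl

+₂-self : ∀ x → x +₂ x ≡ 0₂
+₂-self 0₂ = refl
+₂-self 1₂ = refl

+₂-zero⇒≡ : ∀ x y → x +₂ y ≡ 0₂ → x ≡ y
+₂-zero⇒≡ 0₂ 0₂ _ = refl
+₂-zero⇒≡ 1₂ 1₂ _ = refl
+₂-zero⇒≡ 0₂ 1₂ ()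
+₂-zero⇒≡ 1₂ 0₂ ()

*₂-zeroʳ : ∀ x → x *₂ 0₂ ≡ 0₂
*₂-zeroʳ 0₂ = refl
*₂-zeroʳ 1₂ = refl

*₂-comm : ∀ x y → x *₂ y ≡ y *₂ x
*₂-comm 0₂ y = sym (*₂-zeroʳ y)
*₂-comm 1₂ 0₂ = refl
*₂-comm 1₂ 1₂ = refl

*₂-assoc : ∀ x y z → x *₂ (y *₂ z) ≡ (x *₂ y) *₂ z
*₂-assoc 0₂ _ _ = refl
*₂-assoc 1₂ _ _ = refl

*₂-distribˡ : ∀ a x y → a *₂ (x +₂ y) ≡ (a *₂ x) +₂ (a *₂ y)
*₂-distribˡ 0₂ _ _ = refl
*₂-distribˡ 1₂ _ _ = refl

coeff-⊕ : ∀ n p q → coeff n (p ⊕ q) ≡ coeff n p +₂ coeff n q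
coeff-⊕ n [] q = refl
coeff-⊕ n (a ∷ p) [] = sym (+₂-identityʳ _)
coeff-⊕ zero (a ∷ p) (b ∷ q) = refl
coeff-⊕ (suc n) (a ∷ p) (b ∷ q) = coeff-⊕ n p q

coeff-scale : ∀ n a p → coeff n (scale a p) ≡ a *₂ coeff n p
coeff-scale n a [] = sym (*₂-zeroʳ a)
coeff-scale zero a (b ∷ p) = refl
coeff-scale (suc n) a (b ∷ p) = coeff-scale n a p

⊕-cong : ∀ {p p′ q q′} → p ≈ p′ → q ≈ q′ → p ⊕ q ≈ p′ ⊕ q′
⊕-cong {p} {p′} {q} {q′} e e′ = ≈-coeff λ n →
  trans (coeff-⊕ n p q) (trans (cong₂ _+₂_ (coeff-≈ e n) (coeff-≈ e′ n)) (sym (coeff-⊕ n p′ q′)))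

⊕-comm : ∀ p q → p ⊕ q ≈ q ⊕ p
⊕-comm p q = ≈-coeff λ n →
  trans (coeff-⊕ n p q) (trans (+₂-comm (coeff n p) (coeff n q)) (sym (coeff-⊕ n q p)))

⊕-assoc : ∀ p q r → (p ⊕ q) ⊕ r ≈ p ⊕ (q ⊕ r)
⊕-assoc p q r = ≈-coeff λ n →
  trans (coeff-⊕ n (p ⊕ q) r) (trans (cong (_+₂ coeff n r) (coeff-⊕ n p q))
  (trans (+₂-assoc (coeff n p) (coeff n q) (coeff n r))
  (trans (cong (coeff n p +₂_) (sym (coeff-⊕ n q r))) (sym (coeff-⊕ n p (q ⊕ r))))))

⊕-identityʳ : ∀ p → p ⊕ [] ≈ p
⊕-identityʳ p = ≈-coeff λ n → trans (coeff-⊕ n p []) (+₂-identityʳ _)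

⊕-self : ∀ p → p ⊕ p ≈ []
⊕-self p = ≈-coeff λ n → trans (coeff-⊕ n p p) (+₂-self (coeff n p))

⊕-zero⇒≈ : ∀ {p q} → IsZeroPoly (p ⊕ q) → p ≈ q
⊕-zero⇒≈ {p} {q} z = ≈-coeff λ n →
  +₂-zero⇒≡ (coeff n p) (coeff n q) (trans (sym (coeff-⊕ n p q)) (zero-coeff z n))

⊕-twice : ∀ p q → (p ⊕ q) ⊕ q ≈ p
⊕-twice p q = begin
  (p ⊕ q) ⊕ q  ≈⟨ ⊕-assoc p q q ⟩
  p ⊕ (q ⊕ q)  ≈⟨ ⊕-cong (≈-refl {p}) (⊕-self q) ⟩
  p ⊕ []       ≈⟨ ⊕-identityʳ p ⟩
  p            ∎

⊕-left-comm : ∀ p q r → p ⊕ (q ⊕ r) ≈ q ⊕ (p ⊕ r)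
⊕-left-comm p q r = begin
  p ⊕ (q ⊕ r)  ≈⟨ ⊕-assoc p q r ⟨
  (p ⊕ q) ⊕ r  ≈⟨ ⊕-cong (⊕-comm p q) ≈-refl ⟩
  (q ⊕ p) ⊕ r  ≈⟨ ⊕-assoc q p r ⟩
  q ⊕ (p ⊕ r)  ∎

⊕-interchange : ∀ p q r s → (p ⊕ q) ⊕ (r ⊕ s) ≈ (p ⊕ r) ⊕ (q ⊕ s)
⊕-interchange p q r s = begin
  (p ⊕ q) ⊕ (r ⊕ s)  ≈⟨ ⊕-assoc p q (r ⊕ s) ⟩
  p ⊕ (q ⊕ (r ⊕ s))  ≈⟨ ⊕-cong (≈-refl {p}) (⊕-left-comm q r s) ⟩
  p ⊕ (r ⊕ (q ⊕ s))  ≈⟨ ⊕-assoc p r (q ⊕ s) ⟨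
  (p ⊕ r) ⊕ (q ⊕ s)  ∎

scale-zero-⊕ : ∀ p q → scale 0₂ p ⊕ q ≈ q
scale-zero-⊕ p q = ≈-coeff λ n →
  trans (coeff-⊕ n (scale 0₂ p) q) (cong (_+₂ coeff n q) (coeff-scale n 0₂ p))

scale-⊕ : ∀ a p q → scale a (p ⊕ q) ≈ scale a p ⊕ scale a q
scale-⊕ a p q = ≈-coeff λ n →
  trans (coeff-scale n a (p ⊕ q)) (trans (cong (a *₂_) (coeff-⊕ n p q))
  (trans (*₂-distribˡ a (coeff n p) (coeff n q))
  (trans (cong₂ _+₂_ (sym (coeff-scale n a p)) (sym (coeff-scale n a q)))
         (sym (coeff-⊕ n (scale a p) (scale a q))))))

scale-scale : ∀ a b p → scale a (scale b p) ≈ scale (a *₂ b) p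
scale-scale a b p = ≈-coeff λ n →
  trans (coeff-scale n a (scale b p)) (trans (cong (a *₂_) (coeff-scale n b p))
  (trans (*₂-assoc a b (coeff n p)) (sym (coeff-scale n (a *₂ b) p))))

⊗-shiftˡ : ∀ p q → (0₂ ∷ p) ⊗ q ≈ 0₂ ∷ (p ⊗ q)
⊗-shiftˡ p q = scale-zero-⊕ q (0₂ ∷ p ⊗ q)

⊗-identityˡ : ∀ p → (1₂ ∷ []) ⊗ p ≈ p
⊗-identityˡ p = ≈-coeff λ n →
  trans (coeff-⊕ n (scale 1₂ p) (0₂ ∷ []))
  (trans (cong₂ _+₂_ (coeff-scale n 1₂ p) (coeff-constant-zero n)) (+₂-identityʳ _))
  where
  coeff-constant-zero : ∀ n → coeff n (0₂ ∷ []) ≡ 0₂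
  coeff-constant-zero zero = refl
  coeff-constant-zero (suc n) = refl

⊗-zeroˡ : ∀ p q → IsZeroPoly p → IsZeroPoly (p ⊗ q)
⊗-zeroˡ [] q _ = []
⊗-zeroˡ (_ ∷ p) q (refl ∷ z) = ≈-trans {[]} (refl ∷ ⊗-zeroˡ p q z) (≈-sym (⊗-shiftˡ p q))

⊗-zeroʳ : ∀ p → p ⊗ [] ≈ []
⊗-zeroʳ [] = []
⊗-zeroʳ (a ∷ p) = refl ∷ ≈-sym (⊗-zeroʳ p)

⊗-congˡ : ∀ {p p′} q → p ≈ p′ → p ⊗ q ≈ p′ ⊗ q
⊗-congˡ {[]} {p′} q z = ⊗-zeroˡ p′ q z
⊗-congˡ {a ∷ p} {[]} q z = ≈-sym (⊗-zeroˡ (a ∷ p) q z)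
⊗-congˡ {a ∷ p} {_ ∷ _} q (refl , e) = ⊕-cong ≈-refl (refl , ⊗-congˡ q e)

⊗-consʳ : ∀ p b q → p ⊗ (b ∷ q) ≈ scale b p ⊕ (0₂ ∷ p ⊗ q)
⊗-consʳ [] b q = refl ∷ []
⊗-consʳ (a ∷ p) b q = cong (_+₂ 0₂) (*₂-comm a b) ,
  ≈-trans (⊕-cong ≈-refl (⊗-consʳ p b q)) (⊕-left-comm (scale a q) (scale b p) (0₂ ∷ p ⊗ q))

⊗-shiftʳ : ∀ p q → p ⊗ (0₂ ∷ q) ≈ 0₂ ∷ (p ⊗ q)
⊗-shiftʳ p q = ≈-trans (⊗-consʳ p 0₂ q) (scale-zero-⊕ p (0₂ ∷ p ⊗ q))

⊗-comm : ∀ p q → p ⊗ q ≈ q ⊗ p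
⊗-comm [] q = ≈-sym (⊗-zeroʳ q)
⊗-comm (a ∷ p) q = ≈-trans (⊕-cong ≈-refl (refl , ⊗-comm p q)) (≈-sym (⊗-consʳ q a p))

⊗-congʳ : ∀ p {q q′} → q ≈ q′ → p ⊗ q ≈ p ⊗ q′
⊗-congʳ p {q} {q′} e = ≈-trans (⊗-comm p q) (≈-trans (⊗-congˡ p e) (⊗-comm q′ p))

⊗-distribˡ : ∀ r p q → r ⊗ (p ⊕ q) ≈ r ⊗ p ⊕ r ⊗ q
⊗-distribˡ [] p q = []
⊗-distribˡ (a ∷ r) p q = ≈-trans (⊕-cong (scale-⊕ a p q) (refl , ⊗-distribˡ r p q))
  (⊕-interchange (scale a p) (scale a q) (0₂ ∷ r ⊗ p) (0₂ ∷ r ⊗ q))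

⊗-distribʳ : ∀ p q r → (p ⊕ q) ⊗ r ≈ p ⊗ r ⊕ q ⊗ r
⊗-distribʳ p q r = ≈-trans (⊗-comm (p ⊕ q) r)
  (≈-trans (⊗-distribˡ r p q) (⊕-cong (⊗-comm r p) (⊗-comm r q)))

scale-⊗ : ∀ a p q → scale a (p ⊗ q) ≈ scale a p ⊗ q
scale-⊗ a [] q = []
scale-⊗ a (b ∷ p) q = ≈-trans (scale-⊕ a (scale b q) (0₂ ∷ p ⊗ q))
  (⊕-cong (scale-scale a b q) (*₂-zeroʳ a , scale-⊗ a p q))

⊗-assoc : ∀ p q r → (p ⊗ q) ⊗ r ≈ p ⊗ (q ⊗ r)
⊗-assoc [] q r = []
⊗-assoc (a ∷ p) q r = ≈-trans (⊗-distribʳ (scale a q) (0₂ ∷ p ⊗ q) r)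
  (⊕-cong (≈-sym (scale-⊗ a q r)) (≈-trans (⊗-shiftˡ (p ⊗ q) r) (refl , ⊗-assoc p q r)))

⊗-left-comm : ∀ p q r → p ⊗ (q ⊗ r) ≈ q ⊗ (p ⊗ r)
⊗-left-comm p q r = begin
  p ⊗ (q ⊗ r)  ≈⟨ ⊗-assoc p q r ⟨
  (p ⊗ q) ⊗ r  ≈⟨ ⊗-congˡ r (⊗-comm p q) ⟩
  (q ⊗ p) ⊗ r  ≈⟨ ⊗-assoc q p r ⟩
  q ⊗ (p ⊗ r)  ∎

no-zero-divisors-unit : ∀ a r → IsZeroPoly ((1₂ ∷ a) ⊗ r) → IsZeroPoly r
no-zero-divisors-unit a [] _ = []
no-zero-divisors-unit a (1₂ ∷ r) (() ∷ _)
no-zero-divisors-unit a (0₂ ∷ r) z with ≈-trans {[]} z (⊗-shiftʳ (1₂ ∷ a) r)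
... | _ ∷ rest = refl ∷ no-zero-divisors-unit a r rest

no-zero-divisors : ∀ a r → ¬ IsZeroPoly a → IsZeroPoly (a ⊗ r) → IsZeroPoly r
no-zero-divisors [] r a≠0 _ = ⊥-elim (a≠0 [])
no-zero-divisors (1₂ ∷ a) r _ z = no-zero-divisors-unit a r z
no-zero-divisors (0₂ ∷ a) r a≠0 z with ≈-trans {[]} z (⊗-shiftˡ a r)
... | _ ∷ rest = no-zero-divisors a r (λ a=0 → a≠0 (refl ∷ a=0)) rest

⊗-cancelˡ : ∀ a {p q} → ¬ IsZeroPoly a → a ⊗ p ≈ a ⊗ q → p ≈ q
⊗-cancelˡ a {p} {q} a≠0 e = ⊕-zero⇒≈ (no-zero-divisors a (p ⊕ q) a≠0 (≈-sym (begin
  a ⊗ (p ⊕ q)      ≈⟨ ⊗-distribˡ a p q ⟩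
  a ⊗ p ⊕ a ⊗ q    ≈⟨ ⊕-cong e ≈-refl ⟩
  a ⊗ q ⊕ a ⊗ q    ≈⟨ ⊕-self (a ⊗ q) ⟩
  []               ∎)))

∣-resp : ∀ {d p p′} → p ≈ p′ → d ∣ p → d ∣ p′
∣-resp e (r , r⊗d≈p) = r , ≈-trans r⊗d≈p e

∣-refl : ∀ d → d ∣ d
∣-refl d = 1₂ ∷ [] , ⊗-identityˡ d

∣-⊕ : ∀ {d p q} → d ∣ p → d ∣ q → d ∣ p ⊕ q
∣-⊕ {d} (r , e) (r′ , e′) = r ⊕ r′ , ≈-trans (⊗-distribʳ r r′ d) (⊕-cong e e′)

∣-⊗ : ∀ {d p} x → d ∣ p → d ∣ x ⊗ p
∣-⊗ {d} x (r , e) = x ⊗ r , ≈-trans (⊗-assoc x r d) (⊗-congʳ x e)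

-- Normal forms: a nonzero polynomial is normal when its last coefficient
-- is 1; every polynomial is equal to a normal one or to [].  The length of
-- a normal polynomial is its degree plus one, the measure of Euclid's
-- algorithm.

data Normal : Pol → Set where
  one : Normal (1₂ ∷ [])
  _∷_ : ∀ a {p} → Normal p → Normal (a ∷ p)

Stripped : Pol → Set
Stripped p = p ≡ [] ⊎ Normal p

cons-stripped : ℤ₂ → Pol → Pol
cons-stripped a (c ∷ r) = a ∷ c ∷ r
cons-stripped 0₂ [] = []
cons-stripped 1₂ [] = 1₂ ∷ []

strip : Pol → Pol
strip [] = []
strip (a ∷ p) = cons-stripped a (strip p)

strip-stripped : ∀ p → Stripped (strip p)
strip-stripped [] = inj₁ refl
strip-stripped (a ∷ p) = cons a (strip p) (strip-stripped p)
  where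
  cons : ∀ a r → Stripped r → Stripped (cons-stripped a r)
  cons 0₂ [] _ = inj₁ refl
  cons 1₂ [] _ = inj₂ one
  cons a (c ∷ r) (inj₂ n) = inj₂ (a ∷ n)

strip-≈ : ∀ p → strip p ≈ p
strip-≈ [] = []
strip-≈ (a ∷ p) = ≈-trans (cons-≈ a (strip p)) (refl , strip-≈ p)
  where
  cons-≈ : ∀ a r → cons-stripped a r ≈ a ∷ r
  cons-≈ 0₂ [] = refl ∷ []
  cons-≈ 1₂ [] = refl , []
  cons-≈ a (c ∷ r) = ≈-refl

cons-stripped-length : ∀ a r → length (cons-stripped a r) ≤ suc (length r)
cons-stripped-length 0₂ [] = z≤n
cons-stripped-length 1₂ [] = ≤-refl
cons-stripped-length a (c ∷ r) = ≤-refl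

strip-length : ∀ p → length (strip p) ≤ length p
strip-length [] = z≤n
strip-length (a ∷ p) = ≤-trans (cons-stripped-length a (strip p)) (s≤s (strip-length p))

-- the leading terms of two normal polynomials of equal length cancel
normal-sum-shorter : ∀ {p q} → Normal p → Normal q → length p ≡ length q →
                     length (strip (p ⊕ q)) < length p
normal-sum-shorter one one refl = s≤s z≤n
normal-sum-shorter one (_ ∷ one) ()
normal-sum-shorter one (_ ∷ _ ∷ _) ()
normal-sum-shorter (_ ∷ one) one ()
normal-sum-shorter (_ ∷ _ ∷ _) one ()
normal-sum-shorter {_ ∷ p} {_ ∷ q} (a ∷ np) (b ∷ nq) e =
  s≤s (≤-trans (cons-stripped-length (a +₂ b) (strip (p ⊕ q)))
               (normal-sum-shorter np nq (suc-injective e)))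

shift : ℕ → Pol → Pol
shift k a = replicate k 0₂ ++ a

shift-normal : ∀ k {a} → Normal a → Normal (shift k a)
shift-normal zero n = n
shift-normal (suc k) n = 0₂ ∷ shift-normal k n

X^-⊗ : ∀ k a → X^ k ⊗ a ≈ shift k a
X^-⊗ zero a = ⊗-identityˡ a
X^-⊗ (suc k) a = ≈-trans (⊗-shiftˡ (X^ k) a) (refl , X^-⊗ k a)

shift-length : ∀ (a b : Pol) → length a ≤ length b → length (shift (length b ∸ length a) a) ≡ length b
shift-length a b le =
  trans (length-++ (replicate (length b ∸ length a) 0₂) {a})
        (trans (cong (_+ length a) (length-replicate (length b ∸ length a))) (m∸n+n≡m le))

-- One step of Euclid's algorithm: when deg a ≤ deg b, cancel the leading
-- term of b by x^k a, where k = deg b - deg a.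

reduce : Pol → Pol → Pol
reduce a b = strip (b ⊕ shift (length b ∸ length a) a)

reduce-≈ : ∀ a b → reduce a b ≈ b ⊕ X^ (length b ∸ length a) ⊗ a
reduce-≈ a b = ≈-trans (strip-≈ (b ⊕ shift k a)) (⊕-cong (≈-refl {b}) (≈-sym (X^-⊗ k a)))
  where k = length b ∸ length a

reduce-shorter : ∀ {a b} → Normal a → Normal b → length a ≤ length b →
                 length (reduce a b) < length b
reduce-shorter {a} {b} na nb le =
  normal-sum-shorter {b} {shift k a} nb (shift-normal k na) (sym (shift-length a b le))
  where k = length b ∸ length a

record Bezout (a b : Pol) : Set where
  field
    gcd : Pol
    gcd∣a : gcd ∣ a
    gcd∣b : gcd ∣ b
    u v : Pol
    identity : u ⊗ a ⊕ v ⊗ b ≈ gcd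

bezout-zeroˡ : ∀ b → Bezout [] b
bezout-zeroˡ b = record
  { gcd = b ; gcd∣a = [] , [] ; gcd∣b = ∣-refl b
  ; u = [] ; v = 1₂ ∷ [] ; identity = ⊗-identityˡ b }

bezout-swap : ∀ {a b} → Bezout a b → Bezout b a
bezout-swap {a} {b} B = record
  { gcd = gcd ; gcd∣a = gcd∣b ; gcd∣b = gcd∣a
  ; u = v ; v = u ; identity = ≈-trans (⊕-comm (v ⊗ b) (u ⊗ a)) identity }
  where open Bezout B

bezout-resp : ∀ {a a′ b b′} → a ≈ a′ → b ≈ b′ → Bezout a b → Bezout a′ b′
bezout-resp {a} {a′} {b} {b′} ea eb B = record
  { gcd = gcd ; gcd∣a = ∣-resp ea gcd∣a ; gcd∣b = ∣-resp eb gcd∣b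
  ; u = u ; v = v
  ; identity = ≈-trans (⊕-cong (⊗-congʳ u (≈-sym ea)) (⊗-congʳ v (≈-sym eb))) identity }
  where open Bezout B

bezout-step : ∀ {a b} s → Bezout a (b ⊕ s ⊗ a) → Bezout a b
bezout-step {a} {b} s B = record
  { gcd = gcd ; gcd∣a = gcd∣a
  ; gcd∣b = ∣-resp (⊕-twice b (s ⊗ a)) (∣-⊕ gcd∣b (∣-⊗ s gcd∣a))
  ; u = u ⊕ v ⊗ s ; v = v ; identity = combination }
  where
  open Bezout B
  combination : (u ⊕ v ⊗ s) ⊗ a ⊕ v ⊗ b ≈ gcd
  combination = begin
    (u ⊕ v ⊗ s) ⊗ a ⊕ v ⊗ b          ≈⟨ ⊕-cong (⊗-distribʳ u (v ⊗ s) a) ≈-refl ⟩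
    (u ⊗ a ⊕ (v ⊗ s) ⊗ a) ⊕ v ⊗ b    ≈⟨ ⊕-assoc (u ⊗ a) _ _ ⟩
    u ⊗ a ⊕ ((v ⊗ s) ⊗ a ⊕ v ⊗ b)    ≈⟨ ⊕-cong (≈-refl {u ⊗ a}) (⊕-comm _ (v ⊗ b)) ⟩
    u ⊗ a ⊕ (v ⊗ b ⊕ (v ⊗ s) ⊗ a)    ≈⟨ ⊕-cong (≈-refl {u ⊗ a}) (⊕-cong (≈-refl {v ⊗ b}) (⊗-assoc v s a)) ⟩
    u ⊗ a ⊕ (v ⊗ b ⊕ v ⊗ (s ⊗ a))    ≈⟨ ⊕-cong (≈-refl {u ⊗ a}) (⊗-distribˡ v b (s ⊗ a)) ⟨
    u ⊗ a ⊕ v ⊗ (b ⊕ s ⊗ a)          ≈⟨ identity ⟩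
    gcd                              ∎

euclid : ∀ n a b → Stripped a → Stripped b → length a + length b < n → Bezout a b
euclid zero _ _ _ _ ()
euclid (suc n) a b (inj₁ refl) _ _ = bezout-zeroˡ b
euclid (suc n) a b (inj₂ _) (inj₁ refl) _ = bezout-swap (bezout-zeroˡ a)
euclid (suc n) a b (inj₂ na) (inj₂ nb) (s≤s le) with length a ≤? length b
... | yes a≤b =
  bezout-step (X^ (length b ∸ length a))
    (bezout-resp ≈-refl (reduce-≈ a b)
      (euclid n a (reduce a b) (inj₂ na) (strip-stripped (b ⊕ shift (length b ∸ length a) a))
        (≤-trans (+-monoʳ-< (length a) (reduce-shorter na nb a≤b)) le)))
... | no a≰b =
  bezout-swap (bezout-step (X^ (length a ∸ length b))
    (bezout-resp ≈-refl (reduce-≈ b a) (bezout-swap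
      (euclid n (reduce b a) b (strip-stripped (a ⊕ shift (length a ∸ length b) b)) (inj₂ nb)
        (≤-trans (+-monoˡ-< (length b) (reduce-shorter nb na (<⇒≤ (≰⇒> a≰b)))) le)))))

bezout : ∀ a b → Bezout a b
bezout a b = bezout-resp (strip-≈ a) (strip-≈ b)
  (euclid (suc (length (strip a) + length (strip b))) (strip a) (strip b)
          (strip-stripped a) (strip-stripped b) ≤-refl)

∣-⊗-multiple : ∀ m b g d → b ∣ m ⊗ g → g ∣ d → b ∣ m ⊗ d
∣-⊗-multiple m b g d b∣mg (t , t⊗g≈d) =
  ∣-resp (≈-trans (⊗-left-comm t m g) (⊗-congʳ m t⊗g≈d)) (∣-⊗ t b∣mg)

∣-⊗-gcd : ∀ m b ℓ d → b ∣ m ⊗ ℓ → IsGcd d b ℓ → b ∣ m ⊗ d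
∣-⊗-gcd m b ℓ d b∣mℓ (_ , _ , greatest) =
  ∣-⊗-multiple m b gcd d (∣-resp m⊗g (∣-⊕ (∣-⊗ u (m , ≈-refl)) (∣-⊗ v b∣mℓ)))
                         (greatest gcd gcd∣a gcd∣b)
  where
  open Bezout (bezout b ℓ)
  m⊗g : u ⊗ (m ⊗ b) ⊕ v ⊗ (m ⊗ ℓ) ≈ m ⊗ gcd
  m⊗g = begin
    u ⊗ (m ⊗ b) ⊕ v ⊗ (m ⊗ ℓ)  ≈⟨ ⊕-cong (⊗-left-comm u m b) (⊗-left-comm v m ℓ) ⟩
    m ⊗ (u ⊗ b) ⊕ m ⊗ (v ⊗ ℓ)  ≈⟨ ⊗-distribˡ m (u ⊗ b) (v ⊗ ℓ) ⟨
    m ⊗ (u ⊗ b ⊕ v ⊗ ℓ)        ≈⟨ ⊗-congʳ m identity ⟩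
    m ⊗ gcd                    ∎

red-+ : ∀ a b → red (a +₄ b) ≡ red a +₂ red b
red-+ 0₄ _ = refl
red-+ 1₄ 0₄ = refl
red-+ 1₄ 1₄ = refl
red-+ 1₄ 2₄ = refl
red-+ 1₄ 3₄ = refl
red-+ 2₄ 0₄ = refl
red-+ 2₄ 1₄ = refl
red-+ 2₄ 2₄ = refl
red-+ 2₄ 3₄ = refl
red-+ 3₄ 0₄ = refl
red-+ 3₄ 1₄ = refl
red-+ 3₄ 2₄ = refl
red-+ 3₄ 3₄ = refl

red-* : ∀ a b → red (a *₄ b) ≡ red a *₂ red b
red-* 0₄ _ = refl
red-* 1₄ _ = refl
red-* 2₄ 0₄ = refl
red-* 2₄ 1₄ = refl
red-* 2₄ 2₄ = refl
red-* 2₄ 3₄ = refl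
red-* 3₄ 0₄ = refl
red-* 3₄ 1₄ = refl
red-* 3₄ 2₄ = refl
red-* 3₄ 3₄ = refl

red-⊕ : ∀ p q → red-pol (P₄._⊕_ p q) ≡ red-pol p ⊕ red-pol q
red-⊕ [] q = refl
red-⊕ (a ∷ p) [] = refl
red-⊕ (a ∷ p) (b ∷ q) = cong₂ _∷_ (red-+ a b) (red-⊕ p q)

red-scale : ∀ a p → red-pol (P₄.scale a p) ≡ scale (red a) (red-pol p)
red-scale a [] = refl
red-scale a (b ∷ p) = cong₂ _∷_ (red-* a b) (red-scale a p)

red-⊗ : ∀ p q → red-pol (P₄._⊗_ p q) ≡ red-pol p ⊗ red-pol q
red-⊗ [] q = refl
red-⊗ (a ∷ p) q = trans (red-⊕ (P₄.scale a q) (0₄ ∷ P₄._⊗_ p q))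
  (cong₂ _⊕_ (red-scale a q) (cong (0₂ ∷_) (red-⊗ p q)))

red-zero : ∀ {p} → P₄.IsZeroPoly p → IsZeroPoly (red-pol p)
red-zero [] = []
red-zero (refl ∷ z) = refl ∷ red-zero z

red-cong : ∀ {p q} → P₄._≈_ p q → red-pol p ≈ red-pol q
red-cong {[]} z = red-zero z
red-cong {_ ∷ _} {[]} z = red-zero z
red-cong {_ ∷ _} {_ ∷ _} (refl , e) = refl , red-cong e

coeff-red : ∀ n p → coeff n (red-pol p) ≡ red (P₄.coeff n p)
coeff-red n [] = refl
coeff-red zero (a ∷ p) = refl
coeff-red (suc n) (a ∷ p) = coeff-red n p

-- a monic quaternary polynomial stays nonzero modulo 2: its leading
-- coefficient reduces to 1
red-monic-nonzero : ∀ f → P₄.Monic f → ¬ IsZeroPoly (red-pol f)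
red-monic-nonzero f (n , _ , leading≡1) z
  with trans (sym (trans (coeff-red n f) (cong red leading≡1))) (zero-coeff z n)
... | ()

quotient-mod-2 : ∀ f g h q P → P₄.Monic f →
  P₄._≈_ (P₄._⊗_ (P₄._⊗_ f h) g) P → P₄._≈_ (P₄._⊗_ f q) P →
  red-pol q ≈ red-pol h ⊗ red-pol g
quotient-mod-2 f g h q P monic fhg≈P fq≈P = ⊗-cancelˡ (red-pol f) (red-monic-nonzero f monic) (begin
  red-pol f ⊗ red-pol q                  ≡⟨ red-⊗ f q ⟨
  red-pol (P₄._⊗_ f q)                   ≈⟨ red-cong fq≈P ⟩
  red-pol P                              ≈⟨ red-cong fhg≈P ⟨
  red-pol (P₄._⊗_ (P₄._⊗_ f h) g)        ≡⟨ trans (red-⊗ (P₄._⊗_ f h) g) (cong (_⊗ red-pol g) (red-⊗ f h)) ⟩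
  (red-pol f ⊗ red-pol h) ⊗ red-pol g    ≈⟨ ⊗-assoc (red-pol f) (red-pol h) (red-pol g) ⟩
  red-pol f ⊗ (red-pol h ⊗ red-pol g)    ∎)

mainTheorem1 : (α β : ℕ) → Odd β →
    (f g h q : P₄.Pol) → (b ℓ : P₂.Pol) →
    P₄.Monic f → P₄.Monic g → P₄.Monic h →
    P₄._≈_ (P₄._⊗_ (P₄._⊗_ f h) g) (xⁿ-1₄ β) →
    P₄._≈_ (P₄._⊗_ f q) (xⁿ-1₄ β) →
    P₂._∣_ b (xⁿ-1₂ α) →
    P₂._<ᵈ_ (P₂.deg ℓ) (P₂.deg b) →
    P₂._∣_ b (P₂._⊗_ (red-pol q) ℓ) →
    (∀ d₁ → P₂.IsGcd d₁ b ℓ → P₂._∣_ b (P₂._⊗_ (red-pol q) d₁))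
    × (∀ d₂ → P₂.IsGcd d₂ b (P₂._⊗_ ℓ (red-pol g)) → P₂._∣_ b (P₂._⊗_ (red-pol h) d₂))
mainTheorem1 α β _ f g h q b ℓ monic-f _ _ fhg≈xᵝ-1 fq≈xᵝ-1 _ _ b∣qℓ =
  (λ d₁ → ∣-⊗-gcd (red-pol q) b ℓ d₁ b∣qℓ) ,
  (λ d₂ → ∣-⊗-gcd (red-pol h) b (ℓ ⊗ red-pol g) d₂ (∣-resp qℓ≈h[ℓg] b∣qℓ))
  where
  q≡hg : red-pol q ≈ red-pol h ⊗ red-pol g
  q≡hg = quotient-mod-2 f g h q (xⁿ-1₄ β) monic-f fhg≈xᵝ-1 fq≈xᵝ-1
  qℓ≈h[ℓg] : red-pol q ⊗ ℓ ≈ red-pol h ⊗ (ℓ ⊗ red-pol g)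
  qℓ≈h[ℓg] = begin
    red-pol q ⊗ ℓ                    ≈⟨ ⊗-congˡ ℓ q≡hg ⟩
    (red-pol h ⊗ red-pol g) ⊗ ℓ      ≈⟨ ⊗-assoc (red-pol h) (red-pol g) ℓ ⟩
    red-pol h ⊗ (red-pol g ⊗ ℓ)      ≈⟨ ⊗-congʳ (red-pol h) (⊗-comm (red-pol g) ℓ) ⟩
    red-pol h ⊗ (ℓ ⊗ red-pol g)      ∎
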